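{- For all integers $m,n\geq 3$, $r(m;n) \leq R(P_{n+2}, P^{m+1}_{mn})$.
   Context: For positive integers $m,n$, $r(m;n)$ is the smallest $N$ such that every coloring of the edges of the complete graph $K_N$ with $n$ colors contains a monochromatic complete subgraph on $m$ vertices. An ordered 3-uniform hypergraph is a 3-uniform hypergraph with a totally ordered vertex set; $K^{(3)}_N$ is the complete ordered 3-uniform hypergraph on $[N]=\{1,\dots,N\}$ with the natural order. In a red-blue coloring of the triples of $[N]$, an ordered hypergraph $H$ appears as a red (resp. blue) copy if there is an order-preserving injection $V(H)\to[N]$ sending every edge of $H$ to a red (resp. blue) triple. The monotone path $P_k$ has vertex set $\{1,\dots,k\}$ and edges all consecutive triples $(i,i+1,i+2)$. For $t\ge 3$, the power path $P^t_k$ is the ordered 3-uniform hypergraph on $\{1,\dots,k\}$ in which every set of $t$ consecutive vertices spans a complete 3-uniform hypergraph, i.e. its edges are all triples $i<j<l$ with $l-i\le t-1$. For ordered 3-uniform hypergraphs $F,G$, $R(F,G)$ is the smallest $N$ such that every red-blue coloring of the triples of $K^{(3)}_N$ contains a red copy of $F$ or a blue copy of $G$. -}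

module Defs where

open import Data.Nat using (ℕ; suc; _+_; _*_; _∸_) renaming (_≤_ to _≤ℕ_; _<_ to _<ℕ_)
open import Data.Fin using (Fin; toℕ; _<_)
open import Data.Bool using (Bool; true; false)
open import Data.Sum using (_⊎_)
open import Data.Product using (Σ; _×_; ∃-syntax)
open import Relation.Binary.PropositionalEquality using (_≡_)

IsLeast : (ℕ → Set) → ℕ → Set
IsLeast P N = P N × (∀ M → P M → N ≤ℕ M)

StrictlyIncreasing : ∀ {k N} → (Fin k → Fin N) → Set
StrictlyIncreasing f = ∀ a b → a < b → f a < f b

-- An edge colouring of K_N with n colours: the colour of edge {i,j}
-- with i < j is  c i j  (values with i ≥ j are irrelevant).
EdgeColouring : ℕ → ℕ → Set
EdgeColouring N n = Fin N → Fin N → Fin n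

HasMonoClique : ∀ {N n} → ℕ → EdgeColouring N n → Set
HasMonoClique {N} {n} m c =
  Σ (Fin m → Fin N) λ f → StrictlyIncreasing f ×
    ∃[ col ] (∀ a b → a < b → c (f a) (f b) ≡ col)

MultiRamseyProp : ℕ → ℕ → ℕ → Set
MultiRamseyProp m n N = (c : EdgeColouring N n) → HasMonoClique m c

IsMultiRamsey : ℕ → ℕ → ℕ → Set
IsMultiRamsey m n = IsLeast (MultiRamseyProp m n)

-- Vertex set {1..k} represented as Fin k with its natural order;
-- Edge i j l is meaningful for i < j < l.
record OrdHypergraph : Set₁ where
  field
    size : ℕ
    Edge : Fin size → Fin size → Fin size → Set
open OrdHypergraph public

-- red/blue colouring of triples of [N]: colour of {i<j<l} is χ i j l
-- (true = red, false = blue).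
TripleColouring : ℕ → Set
TripleColouring N = Fin N → Fin N → Fin N → Bool

red blue : Bool
red = true
blue = false

HasCopy : ∀ {N} → Bool → OrdHypergraph → TripleColouring N → Set
HasCopy {N} col H χ =
  Σ (Fin (size H) → Fin N) λ f → StrictlyIncreasing f ×
    (∀ i j l → i < j → j < l → Edge H i j l → χ (f i) (f j) (f l) ≡ col)

MonotonePath : ℕ → OrdHypergraph
MonotonePath k = record
  { size = k
  ; Edge = λ i j l → (toℕ j ≡ suc (toℕ i)) × (toℕ l ≡ suc (toℕ j)) }

PowerPath : ℕ → ℕ → OrdHypergraph
PowerPath t k = record
  { size = k
  ; Edge = λ i j l → (i < j) × (j < l) × (toℕ l ∸ toℕ i ≤ℕ t ∸ 1) }

HypRamseyProp : OrdHypergraph → OrdHypergraph → ℕ → Set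
HypRamseyProp F G N = (χ : TripleColouring N) → HasCopy red F χ ⊎ HasCopy blue G χ

IsHypRamsey : OrdHypergraph → OrdHypergraph → ℕ → Set
IsHypRamsey F G = IsLeast (HypRamseyProp F G)

{-# OPTIONS --safe #-}
module Submission where

-- Colour a triple x < y < z red when c(x,y) < c(y,z) and blue otherwise.  A red monotone
-- path on n + 2 vertices would carry n + 1 strictly increasing colours below n, so there is
-- a blue P^{m+1}_{mn}.  Along it the colours of consecutive edges never increase, and an edge
-- between vertices less than m apart is squeezed between two consecutive-edge colours.
-- Framed by colour n - 1 before the path and colour 0 after it, the consecutive-edge colours
-- cannot drop across each of the n blocks of m steps, and the m vertices of a block on which
-- they stay constant form a monochromatic clique.

open import Defs
open import Data.Nat using (ℕ; _≤_; _*_; _+_)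
open import Data.Nat.Base
  using (zero; suc; pred; _∸_; _<_; _≤′_; ≤′-refl; ≤′-step; z≤n; s≤s; s≤s⁻¹; z<s; _<ᵇ_; NonZero; >-nonZero)
open import Data.Nat.Properties
open import Data.Nat.DivMod using (_mod_; m<n⇒m%n≡m)
open import Data.Fin.Base using (Fin; toℕ; fromℕ<)
open import Data.Fin.Properties using (toℕ-fromℕ<; toℕ<n; toℕ≤pred[n]; toℕ-injective)
open import Data.Bool.Base using (T)
open import Data.Sum.Base using (inj₁; inj₂)
open import Data.Product.Base using (∃-syntax; _×_; _,_; proj₁; proj₂)
open import Function.Base using (_∘_)
open import Relation.Nullary using (¬_; yes; no; contradiction)
open import Relation.Binary.PropositionalEquality

ascentColouring : ∀ {N n} → EdgeColouring N n → TripleColouring N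
ascentColouring c x y z = toℕ (c x y) <ᵇ toℕ (c y z)

module _ {N n} (c : EdgeColouring N n) {x y z : Fin N} where

  ascent-red : ascentColouring c x y z ≡ red → toℕ (c x y) < toℕ (c y z)
  ascent-red isRed = <ᵇ⇒< _ _ (subst T (sym isRed) _)

  ascent-blue : ascentColouring c x y z ≡ blue → toℕ (c y z) ≤ toℕ (c x y)
  ascent-blue isBlue = ≮⇒≥ λ lt → subst T isBlue (<⇒<ᵇ lt)

increasing⇒k≤s[k] : ∀ (s : ℕ → ℕ) k → (∀ t → t < k → s t < s (suc t)) → k ≤ s k
increasing⇒k≤s[k] s zero    _   = z≤n
increasing⇒k≤s[k] s (suc k) inc =
  ≤-<-trans (increasing⇒k≤s[k] s k (λ t t<k → inc t (m<n⇒m<1+n t<k))) (inc k ≤-refl)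

nonIncreasing⇒plateau : ∀ (s : ℕ → ℕ) k → s 0 < k → (∀ j → j < k → s (suc j) ≤ s j) →
                        ∃[ j ] j < k × s (suc j) ≡ s j
nonIncreasing⇒plateau s zero    ()     _
nonIncreasing⇒plateau s (suc k) s₀<1+k desc with s 1 ≟ s 0
... | yes s₁≡s₀ = 0 , z<s , s₁≡s₀
... | no  s₁≢s₀ =
  let s₁<k = <-≤-trans (≤∧≢⇒< (desc 0 z<s) s₁≢s₀) (s≤s⁻¹ s₀<1+k)
      j , j<k , plateau = nonIncreasing⇒plateau (s ∘ suc) k s₁<k (λ j j<k → desc (suc j) (s≤s j<k))
  in suc j , s≤s j<k , plateau

module DescendingColours {n m : ℕ} (colour : ℕ → ℕ → ℕ) (2≤m : 2 ≤ m) (colour01<n : colour 0 1 < n)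
  (descending : ∀ a b l → a < b → b < l → l ≤ a + m → colour b l ≤ colour a b) where

  pathColour : ℕ → ℕ
  pathColour t = colour t (suc t)

  pathColour-step : ∀ t → pathColour (suc t) ≤ pathColour t
  pathColour-step t = descending t (suc t) (suc (suc t)) ≤-refl ≤-refl
                        (≤-trans (≤-reflexive (+-comm 2 t)) (+-monoʳ-≤ t 2≤m))

  pathColour-antitone : ∀ {s t} → s ≤′ t → pathColour t ≤ pathColour s
  pathColour-antitone ≤′-refl        = ≤-refl
  pathColour-antitone (≤′-step s≤′t) = ≤-trans (pathColour-step _) (pathColour-antitone s≤′t)

  plateau⇒constant : ∀ {k t} → pathColour (k + m) ≡ pathColour k → k ≤ t → t ≤ k + m →
                     pathColour t ≡ pathColour k
  plateau⇒constant plateau k≤t t≤k+m =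
    ≤-antisym (pathColour-antitone (≤⇒≤′ k≤t))
              (≤-trans (≤-reflexive (sym plateau)) (pathColour-antitone (≤⇒≤′ t≤k+m)))

  colour≤pathColour : ∀ {a b} → suc a < b → b ≤ a + m → colour (suc a) b ≤ pathColour a
  colour≤pathColour 1+a<b b≤a+m = descending _ _ _ ≤-refl 1+a<b b≤a+m

  pathColour≤colour : ∀ {a b} → a < b → b < a + m → pathColour b ≤ colour a b
  pathColour≤colour a<b b<a+m = descending _ _ _ a<b ≤-refl b<a+m

  plateau⇒monochromatic : ∀ k → pathColour (k + m) ≡ pathColour k →
                          ∀ a b → k < a → a < b → b ≤ k + m → colour a b ≡ pathColour k
  plateau⇒monochromatic k plateau (suc a) b (s≤s k≤a) 1+a<b b≤k+m = ≤-antisym upper lower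
    where
    a<b : a < b
    a<b = ≤-trans (n≤1+n _) 1+a<b
    a≤k+m : a ≤ k + m
    a≤k+m = <⇒≤ (<-≤-trans a<b b≤k+m)
    b≤a+m : b ≤ a + m
    b≤a+m = ≤-trans b≤k+m (+-monoˡ-≤ m k≤a)
    upper : colour (suc a) b ≤ pathColour k
    upper = ≤-trans (colour≤pathColour 1+a<b b≤a+m) (≤-reflexive (plateau⇒constant plateau k≤a a≤k+m))
    lower : pathColour k ≤ colour (suc a) b
    lower = ≤-trans (≤-reflexive (sym (plateau⇒constant plateau (≤-trans k≤a (<⇒≤ a<b)) b≤k+m)))
                    (pathColour≤colour 1+a<b (s≤s b≤a+m))

  MonochromaticRunAt : ℕ → Set
  MonochromaticRunAt k = k + m ≤ m * n × (∀ a b → k < a → a < b → b ≤ k + m → colour a b ≡ pathColour k)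

  monochromaticRun : ∃[ k ] MonochromaticRunAt k
  monochromaticRun =
    let j , j<n , plateau = nonIncreasing⇒plateau (λ j → pathColour (j * m)) n colour01<n
                              (λ j _ → pathColour-antitone (≤⇒≤′ (m≤n+m (j * m) m)))
    in j * m , blockFits j<n
             , plateau⇒monochromatic (j * m) (trans (cong pathColour (+-comm (j * m) m)) plateau)
    where
    blockFits : ∀ {j} → j < n → j * m + m ≤ m * n
    blockFits {j} j<n = begin
      j * m + m ≡⟨ +-comm (j * m) m ⟩
      suc j * m ≤⟨ *-monoˡ-≤ m j<n ⟩
      n * m     ≡⟨ *-comm n m ⟩
      m * n     ∎
      where open ≤-Reasoning

toℕ-mod : ∀ {a P} .{{_ : NonZero P}} → a < P → toℕ (a mod P) ≡ a
toℕ-mod a<P = trans (toℕ-fromℕ< _) (m<n⇒m%n≡m a<P)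

noRedAscendingPath : ∀ {N n} (c : EdgeColouring N n) →
                     ¬ HasCopy red (MonotonePath (n + 2)) (ascentColouring c)
noRedAscendingPath {N} {n} c (f , _ , isRed) =
  <⇒≱ (toℕ<n (c (v n) (v (suc n)))) (increasing⇒k≤s[k] edgeColour n ascends)
  where
  instance
    n+2≢0 : NonZero (n + 2)
    n+2≢0 = subst NonZero (+-comm 2 n) _

  v : ℕ → Fin N
  v t = f (t mod (n + 2))

  edgeColour : ℕ → ℕ
  edgeColour t = toℕ (c (v t) (v (suc t)))

  ascends : ∀ t → t < n → edgeColour t < edgeColour (suc t)
  ascends t t<n = ascent-red c (isRed (t mod _) (suc t mod _) (suc (suc t) mod _)
                                  (subst₂ _<_ (sym toℕ-i) (sym toℕ-j) ≤-refl)
                                  (subst₂ _<_ (sym toℕ-j) (sym toℕ-l) ≤-refl)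
                                  (trans toℕ-j (cong suc (sym toℕ-i)) , trans toℕ-l (cong suc (sym toℕ-j))))
    where
    2+t<n+2 : suc (suc t) < n + 2
    2+t<n+2 = subst (suc (suc t) <_) (+-comm 2 n) (s≤s (s≤s t<n))
    toℕ-l : toℕ (suc (suc t) mod (n + 2)) ≡ suc (suc t)
    toℕ-l = toℕ-mod 2+t<n+2
    toℕ-j : toℕ (suc t mod (n + 2)) ≡ suc t
    toℕ-j = toℕ-mod (≤-trans (n≤1+n _) 2+t<n+2)
    toℕ-i : toℕ (t mod (n + 2)) ≡ t
    toℕ-i = toℕ-mod (≤-trans (n≤1+n _) (≤-trans (n≤1+n _) 2+t<n+2))

module BluePowerPath {N m n : ℕ} .{{_ : NonZero n}} (2≤m : 2 ≤ m) (c : EdgeColouring N n)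
  (copy : HasCopy blue (PowerPath (m + 1) (m * n)) (ascentColouring c)) where

  P : ℕ
  P = m * n

  instance
    P≢0 : NonZero P
    P≢0 = m*n≢0 m n {{>-nonZero (<-trans z<s 2≤m)}}

  v : ℕ → Fin N
  v t = proj₁ copy (t mod P)

  blueTriple : ∀ {a b l} → a < b → b < l → l < P → l ≤ a + m → toℕ (c (v b) (v l)) ≤ toℕ (c (v a) (v b))
  blueTriple {a} {b} {l} a<b b<l l<P l≤a+m =
    ascent-blue c (proj₂ (proj₂ copy) (a mod P) (b mod P) (l mod P) a<b′ b<l′ (a<b′ , b<l′ , span))
    where
    toℕ-l : toℕ (l mod P) ≡ l
    toℕ-l = toℕ-mod l<P
    toℕ-b : toℕ (b mod P) ≡ b
    toℕ-b = toℕ-mod (<-trans b<l l<P)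
    toℕ-a : toℕ (a mod P) ≡ a
    toℕ-a = toℕ-mod (<-trans a<b (<-trans b<l l<P))
    a<b′ : toℕ (a mod P) < toℕ (b mod P)
    a<b′ = subst₂ _<_ (sym toℕ-a) (sym toℕ-b) a<b
    b<l′ : toℕ (b mod P) < toℕ (l mod P)
    b<l′ = subst₂ _<_ (sym toℕ-b) (sym toℕ-l) b<l
    span : toℕ (l mod P) ∸ toℕ (a mod P) ≤ m + 1 ∸ 1
    span = subst₂ (λ x y → x ∸ y ≤ m + 1 ∸ 1) (sym toℕ-l) (sym toℕ-a)
             (subst (l ∸ a ≤_) (sym (m+n∸n≡m m 1)) (m≤n+o⇒m∸n≤o l a l≤a+m))

  -- Path vertex t sits at position t + 1; position 0 is a virtual vertex joined in colour n - 1
  -- and positions beyond the path are virtual vertices joined in colour 0.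
  colour : ℕ → ℕ → ℕ
  colour zero    _       = pred n
  colour (suc a) zero    = 0
  colour (suc a) (suc b) with b <? P
  ... | yes _ = toℕ (c (v a) (v b))
  ... | no  _ = 0

  colour-inside : ∀ {a b} → b < P → colour (suc a) (suc b) ≡ toℕ (c (v a) (v b))
  colour-inside {b = b} b<P with b <? P
  ... | yes _   = refl
  ... | no  b≮P = contradiction b<P b≮P

  colour≤pred[n] : ∀ a b → colour a b ≤ pred n
  colour≤pred[n] zero    _       = ≤-refl
  colour≤pred[n] (suc a) zero    = z≤n
  colour≤pred[n] (suc a) (suc b) with b <? P
  ... | yes _ = toℕ≤pred[n] _
  ... | no  _ = z≤n

  descending : ∀ a b l → a < b → b < l → l ≤ a + m → colour b l ≤ colour a b
  descending zero    b       l       _         _         _           = colour≤pred[n] b l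
  descending (suc a) (suc b) (suc l) (s≤s a<b) (s≤s b<l) (s≤s l≤a+m) with l <? P
  ... | yes l<P = subst (_ ≤_) (sym (colour-inside (<-trans b<l l<P))) (blueTriple a<b b<l l<P l≤a+m)
  ... | no  _   = z≤n

  open DescendingColours colour 2≤m (m≤pred[n]⇒suc[m]≤n ≤-refl) descending

  run⇒monoClique : ∀ {k} → MonochromaticRunAt k → HasMonoClique m c
  run⇒monoClique {k} (k+m≤P , monochromatic) = g , g-increasing , fromℕ< e<n , g-monochromatic
    where
    k+x<P : ∀ x → k + toℕ x < P
    k+x<P x = <-≤-trans (+-monoʳ-< k (toℕ<n x)) k+m≤P

    g : Fin m → Fin N
    g x = v (k + toℕ x)

    g-increasing : StrictlyIncreasing g
    g-increasing x y x<y = proj₁ (proj₂ copy) _ _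
      (subst₂ _<_ (sym (toℕ-mod (k+x<P x))) (sym (toℕ-mod (k+x<P y))) (+-monoʳ-< k x<y))

    e<n : pathColour k < n
    e<n = m≤pred[n]⇒suc[m]≤n (colour≤pred[n] k (suc k))

    g-monochromatic : ∀ x y → toℕ x < toℕ y → c (g x) (g y) ≡ fromℕ< e<n
    g-monochromatic x y x<y = toℕ-injective (begin
      toℕ (c (g x) (g y))                         ≡⟨ colour-inside (k+x<P y) ⟨
      colour (suc (k + toℕ x)) (suc (k + toℕ y)) ≡⟨ monochromatic _ _ (s≤s (m≤m+n k _))
                                                       (s≤s (+-monoʳ-< k x<y)) (+-monoʳ-< k (toℕ<n y)) ⟩
      pathColour k                                ≡⟨ toℕ-fromℕ< e<n ⟨
      toℕ (fromℕ< e<n)                            ∎)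
      where open ≡-Reasoning

  monoClique : HasMonoClique m c
  monoClique = run⇒monoClique (proj₂ monochromaticRun)

mainTheorem3 : ∀ (m n : ℕ) → 3 ≤ m → 3 ≤ n → ∀ (r R : ℕ)
    → IsMultiRamsey m n r
    → IsHypRamsey (MonotonePath (n + 2)) (PowerPath (m + 1) (m * n)) R
    → r ≤ R
mainTheorem3 m n 3≤m 3≤n r R (_ , r-least) (R-ramsey , _) = r-least R everyColouringHasMonoClique
  where
  everyColouringHasMonoClique : MultiRamseyProp m n R
  everyColouringHasMonoClique c with R-ramsey (ascentColouring c)
  ... | inj₁ redPath  = contradiction redPath (noRedAscendingPath c)
  ... | inj₂ bluePath = BluePowerPath.monoClique {{>-nonZero (≤-trans (s≤s z≤n) 3≤n)}}
                          (≤-trans (n≤1+n 2) 3≤m) c bluePath
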